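{- Let $k\in\mathbb{N}$, let $G_1,\ldots,G_k$ be ordered graphs, and let $G=G_1+\cdots+G_k$. Suppose that for each $i\in[k]$ there is an integer $m(i)$ such that $G_i$ has at least two distinct irreducible induced ordered subgraphs on $m(i)$ vertices. Then $S_n(G)\geqslant 2^{n-1}$ for each $n\leqslant k$.
   Context: An ordered graph of order $n$ is a graph on vertex set $[n]$ with the natural order. For ordered graphs $G_1,\dots,G_m$ of orders $n_1,\dots,n_m$, with $N_i=n_1+\cdots+n_i$, the ordered graph $G_1+\cdots+G_m$ has vertex set $[N_m]$ and, for each $i$, a copy of $G_i$ on the interval $[N_{i-1}+1,N_i]$ (via $v\mapsto v-N_{i-1}$), with no edges between different intervals. A pair of vertices $u<v$ separates the edges of an ordered graph if every edge $ij$ with $i<j$ has $j\leqslant u$ or $v\leqslant i$; the graph is irreducible if no pair separates its edges. "Distinct" means non-isomorphic as ordered graphs. $S_n(G)$ is the number of distinct induced ordered subgraphs of $G$ of order $n$. -}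

module Defs where

open import Data.Nat using (ℕ; zero; suc; _+_; _∸_; _^_; _≤_)
open import Data.Fin using (Fin; zero; suc; splitAt; _<_)
open import Data.Bool using (Bool; true; false)
open import Data.Sum using (_⊎_; inj₁; inj₂)
open import Data.Product using (Σ; _×_; _,_)
open import Relation.Binary.PropositionalEquality using (_≡_; _≢_; refl)
open import Relation.Nullary using (¬_)
open import Function.Bundles using (_↔_; Inverse)

-- An ordered graph of order n: a simple graph on vertex set Fin n
-- (representing [n] = {1,...,n}) with the natural order on Fin n.
record OGraph (n : ℕ) : Set where
  field
    adj   : Fin n → Fin n → Bool
    sym   : ∀ i j → adj i j ≡ adj j i
    irrefl : ∀ i → adj i i ≡ false
open OGraph public

Edge : ∀ {n} → OGraph n → Fin n → Fin n → Set
Edge G i j = adj G i j ≡ true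

combine : ∀ {a b} → OGraph a → OGraph b → Fin a ⊎ Fin b → Fin a ⊎ Fin b → Bool
combine G H (inj₁ i) (inj₁ j) = adj G i j
combine G H (inj₂ i) (inj₂ j) = adj H i j
combine G H (inj₁ i) (inj₂ j) = false
combine G H (inj₂ i) (inj₁ j) = false

combine-sym : ∀ {a b} (G : OGraph a) (H : OGraph b) x y →
              combine G H x y ≡ combine G H y x
combine-sym G H (inj₁ i) (inj₁ j) = sym G i j
combine-sym G H (inj₂ i) (inj₂ j) = sym H i j
combine-sym G H (inj₁ i) (inj₂ j) = refl
combine-sym G H (inj₂ i) (inj₁ j) = refl

combine-irr : ∀ {a b} (G : OGraph a) (H : OGraph b) x → combine G H x x ≡ false
combine-irr G H (inj₁ i) = irrefl G i
combine-irr G H (inj₂ i) = irrefl H i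

_⊕_ : ∀ {a b} → OGraph a → OGraph b → OGraph (a + b)
_⊕_ {a} G H = record
  { adj = λ x y → combine G H (splitAt a x) (splitAt a y)
  ; sym = λ x y → combine-sym G H (splitAt a x) (splitAt a y)
  ; irrefl = λ x → combine-irr G H (splitAt a x)
  }

emptyGraph : OGraph 0
emptyGraph = record { adj = λ () ; sym = λ () ; irrefl = λ () }

total : (k : ℕ) → (Fin k → ℕ) → ℕ
total zero ns = 0
total (suc k) ns = ns zero + total k (λ i → ns (suc i))

sumGraphs : (k : ℕ) (ns : Fin k → ℕ) → ((i : Fin k) → OGraph (ns i)) →
            OGraph (total k ns)
sumGraphs zero ns Gs = emptyGraph
sumGraphs (suc k) ns Gs = Gs zero ⊕ sumGraphs k (λ i → ns (suc i)) (λ i → Gs (suc i))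

record Emb (m n : ℕ) : Set where
  field
    emb  : Fin m → Fin n
    mono : ∀ i j → i < j → emb i < emb j
open Emb public

induced : ∀ {m n} → OGraph n → Emb m n → OGraph m
induced G e = record
  { adj = λ i j → adj G (emb e i) (emb e j)
  ; sym = λ i j → sym G (emb e i) (emb e j)
  ; irrefl = λ i → irrefl G (emb e i)
  }

Iso : ∀ {n} → OGraph n → OGraph n → Set
Iso {n} G H = Σ (Fin n ↔ Fin n) λ f →
  (∀ i j → i < j → Inverse.to f i < Inverse.to f j) ×
  (∀ i j → adj G i j ≡ adj H (Inverse.to f i) (Inverse.to f j))

Separates : ∀ {n} → OGraph n → Fin n → Fin n → Set
Separates G u v = ∀ i j → i < j → Edge G i j → (j Data.Fin.≤ u) ⊎ (v Data.Fin.≤ i)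

Irreducible : ∀ {n} → OGraph n → Set
Irreducible {n} G = ∀ (u v : Fin n) → u < v → ¬ Separates G u v

TwoDistinctIrreducible : ∀ {n} → OGraph n → ℕ → Set
TwoDistinctIrreducible {n} G m =
  Σ (Emb m n) λ e₁ → Σ (Emb m n) λ e₂ →
    Irreducible (induced G e₁) × Irreducible (induced G e₂) ×
    ¬ Iso (induced G e₁) (induced G e₂)

SAtLeast : ∀ {n} → OGraph n → (m N : ℕ) → Set
SAtLeast {n} G m N =
  Σ (Fin N → Emb m n) λ es →
    ∀ a b → a ≢ b → ¬ Iso (induced G (es a)) (induced G (es b))

-- An isomorphism of ordered graphs on [n] is order preserving, hence the identity, so distinct
-- induced subgraphs are exactly those with different adjacency. In G₁ + G₂ take the sum of an
-- s-vertex induced subgraph of G₁ without an edge-free cut and an (n − s)-vertex one of G₂: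
-- then s is the order of the first irreducible block, which adjacency determines. From one
-- irreducible subgraph A of order m, a prefix of A plus one further vertex gives such a subgraph
-- of every order s < m, and for s = m there are two, A and B. Given 2^(r−1) distinct r-vertex
-- subgraphs of G₂, the choices s = 1, …, m − 1 contribute 2^(n−2), …, 2^(n−m) and s = m
-- contributes 2 · 2^(n−m−1), in total 2^(n−1).

module Submission where

open import Defs hiding (sym)
open import Data.Nat using (ℕ; zero; suc; _+_; _∸_; _^_; _≤_; _<_; z≤n; s≤s; s≤s⁻¹; _≤?_; _<?_)
open import Data.Nat.Properties
open import Data.Fin as Fin using (Fin; zero; suc; toℕ; fromℕ; fromℕ<; inject₁; splitAt; join; _↑ˡ_; _↑ʳ_)
open import Data.Fin.Properties
  using (toℕ-inject₁; toℕ-injective; inject≤-injective; toℕ-fromℕ; toℕ-fromℕ<; toℕ<n; any?; toℕ-↑ˡ; toℕ-↑ʳ; splitAt-↑ˡ; splitAt-↑ʳ;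
         splitAt-<; splitAt-≥; splitAt-join; join-splitAt)
open import Data.Bool using (true; false)
open import Data.Bool.Properties using (not-¬; ¬-not) renaming (_≟_ to _≟ᵇ_)
open import Data.Sum as Sum using (_⊎_; inj₁; inj₂)
open import Data.Product using (Σ; ∃; ∃₂; _×_; _,_; proj₁; proj₂)
open import Data.List using (List; []; _∷_; _++_; map; length; lookup)
open import Data.List.Properties using (length-map; length-++)
open import Data.List.Membership.Propositional.Properties using (∈-lookup)
open import Data.List.Relation.Unary.All as All using (All; []; _∷_)
import Data.List.Relation.Unary.All.Properties as All
open import Data.List.Relation.Unary.AllPairs as AllPairs using (AllPairs; []; _∷_)
import Data.List.Relation.Unary.AllPairs.Properties as AllPairs
open import Relation.Binary.PropositionalEquality
open import Relation.Binary.Definitions using (tri<; tri≈; tri>)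
open import Relation.Nullary using (¬_; contradiction; Dec; yes; no)
open import Relation.Nullary.Decidable using (_×-dec_)
open import Function.Base using (_∘_)
open import Function.Bundles using (_↔_; Inverse)
open import Function.Construct.Identity using (↔-id)

AllPairs-lookup : ∀ {A : Set} {R : A → A → Set} → (∀ {x y} → R x y → R y x) →
                  ∀ {xs} → AllPairs R xs → ∀ {i j} → i ≢ j → R (lookup xs i) (lookup xs j)
AllPairs-lookup R-sym (_  ∷ _)   {zero}  {zero}  0≢0 = contradiction refl 0≢0
AllPairs-lookup R-sym (Rx ∷ _)   {zero}  {suc j} _   = All.lookup Rx (∈-lookup j)
AllPairs-lookup R-sym (Rx ∷ _)   {suc i} {zero}  _   = R-sym (All.lookup Rx (∈-lookup i))
AllPairs-lookup R-sym (_  ∷ Rxs) {suc i} {suc j} i≢j = AllPairs-lookup R-sym Rxs (i≢j ∘ cong suc)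

All-map-universal : ∀ {A B : Set} {P : B → Set} {f : A → B} → (∀ x → P (f x)) → ∀ xs → All P (map f xs)
All-map-universal Pf xs = All.map⁺ (All.universal Pf xs)

infix 4 _≋_

record _≋_ {n} (G H : OGraph n) : Set where
  constructor sameAdjacency
  field adj-≡ : ∀ i j → adj G i j ≡ adj H i j
open _≋_

≋-sym : ∀ {n} {G H : OGraph n} → G ≋ H → H ≋ G
≋-sym G≋H = sameAdjacency λ i j → sym (adj-≡ G≋H i j)

≋-trans : ∀ {n} {G H K : OGraph n} → G ≋ H → H ≋ K → G ≋ K
≋-trans G≋H H≋K = sameAdjacency λ i j → trans (adj-≡ G≋H i j) (adj-≡ H≋K i j)

StrictlyIncreasing : ∀ {m n} → (Fin m → Fin n) → Set
StrictlyIncreasing h = ∀ i j → i Fin.< j → h i Fin.< h j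

strictlyIncreasing⇒≥ : ∀ {m n} (h : Fin m → Fin n) → StrictlyIncreasing h →
                       ∀ i → toℕ i ≤ toℕ (h i)
strictlyIncreasing⇒≥ h inc zero = z≤n
strictlyIncreasing⇒≥ h inc (suc i) = begin-strict
  toℕ i                 ≤⟨ strictlyIncreasing⇒≥ (h ∘ inject₁) inc∘inject₁ i ⟩
  toℕ (h (inject₁ i))   <⟨ inc (inject₁ i) (suc i) inject₁i<suci ⟩
  toℕ (h (suc i))       ∎
  where
  open ≤-Reasoning
  inject₁i<suci : inject₁ i Fin.< suc i
  inject₁i<suci = s≤s (≤-reflexive (toℕ-inject₁ i))
  inc∘inject₁ : StrictlyIncreasing (h ∘ inject₁)
  inc∘inject₁ i j i<j = inc (inject₁ i) (inject₁ j) (subst₂ _<_ (sym (toℕ-inject₁ i)) (sym (toℕ-inject₁ j)) i<j)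

module _ {n} (f : Fin n ↔ Fin n) (inc : StrictlyIncreasing (Inverse.to f)) where
  open Inverse f

  inverse-strictlyIncreasing : StrictlyIncreasing from
  inverse-strictlyIncreasing i j i<j with <-cmp (toℕ (from i)) (toℕ (from j))
  ... | tri< from-i<from-j _ _ = from-i<from-j
  ... | tri≈ _ from-i≡from-j _ = contradiction i<j (<-irrefl (cong toℕ i≡j))
    where
    i≡j : i ≡ j
    i≡j = begin
      i               ≡⟨ strictlyInverseˡ i ⟨
      to (from i)     ≡⟨ cong to (toℕ-injective from-i≡from-j) ⟩
      to (from j)     ≡⟨ strictlyInverseˡ j ⟩
      j               ∎
      where open ≡-Reasoning
  ... | tri> _ _ from-j<from-i = contradiction i<j (<-asym (subst₂ _<_
          (cong toℕ (strictlyInverseˡ j)) (cong toℕ (strictlyInverseˡ i)) (inc _ _ from-j<from-i)))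

  order-automorphism-id : ∀ i → to i ≡ i
  order-automorphism-id i = trans (cong to (sym from-i≡i)) (strictlyInverseˡ i)
    where
    from-i≡i : from i ≡ i
    from-i≡i = toℕ-injective (≤-antisym
      (≤-trans (strictlyIncreasing⇒≥ to inc (from i)) (≤-reflexive (cong toℕ (strictlyInverseˡ i))))
      (strictlyIncreasing⇒≥ from inverse-strictlyIncreasing i))

Iso⇒≋ : ∀ {n} {G H : OGraph n} → Iso G H → G ≋ H
Iso⇒≋ {H = H} (f , inc , preserves) = sameAdjacency λ i j →
  trans (preserves i j) (cong₂ (adj H) (order-automorphism-id f inc i) (order-automorphism-id f inc j))

≋⇒Iso : ∀ {n} {G H : OGraph n} → G ≋ H → Iso G H
≋⇒Iso G≋H = ↔-id _ , (λ i j i<j → i<j) , adj-≡ G≋H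

NoEdgeAcross : ∀ {n} → OGraph n → ℕ → Set
NoEdgeAcross G c = ∀ i j → toℕ i < c → c ≤ toℕ j → adj G i j ≡ false

ConnectedBelow : ∀ {n} → OGraph n → ℕ → Set
ConnectedBelow G t = ∀ c → 0 < c → c < t → ¬ NoEdgeAcross G c

Connected : ∀ {n} → OGraph n → Set
Connected {n} G = ConnectedBelow G n

-- The first irreducible block of G has order t: t is the least positive cut crossed by no edge.
FirstBlock : ∀ {n} → OGraph n → ℕ → Set
FirstBlock G t = NoEdgeAcross G t × ConnectedBelow G t

NoEdgeAcross-resp-≋ : ∀ {n c} {G H : OGraph n} → G ≋ H → NoEdgeAcross G c → NoEdgeAcross H c
NoEdgeAcross-resp-≋ G≋H cut i j i<c c≤j = trans (sym (adj-≡ G≋H i j)) (cut i j i<c c≤j)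

FirstBlock-resp-≋ : ∀ {n t} {G H : OGraph n} → G ≋ H → FirstBlock G t → FirstBlock H t
FirstBlock-resp-≋ G≋H (cut , connected) =
  NoEdgeAcross-resp-≋ G≋H cut , λ c 0<c c<t → connected c 0<c c<t ∘ NoEdgeAcross-resp-≋ (≋-sym G≋H)

FirstBlock-distinct : ∀ {n t u} {G H : OGraph n} → FirstBlock G t → FirstBlock H u →
                      0 < t → t < u → ¬ G ≋ H
FirstBlock-distinct (cut , _) (_ , connected) 0<t t<u G≋H =
  connected _ 0<t t<u (NoEdgeAcross-resp-≋ G≋H cut)

Irreducible⇒Connected : ∀ {n} (G : OGraph n) → Irreducible G → Connected G
Irreducible⇒Connected G irreducible (suc g) _ g<n cut = irreducible u v u<v separates
  where
  u = fromℕ< (<-trans (n<1+n g) g<n)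
  v = fromℕ< g<n
  u<v : u Fin.< v
  u<v = subst₂ _<_ (sym (toℕ-fromℕ< _)) (sym (toℕ-fromℕ< _)) (n<1+n g)
  separates : Separates G u v
  separates i j _ edge with toℕ j ≤? g | suc g ≤? toℕ i
  ... | yes j≤g | _       = inj₁ (subst (toℕ j ≤_) (sym (toℕ-fromℕ< _)) j≤g)
  ... | no _    | yes g<i = inj₂ (subst (_≤ toℕ i) (sym (toℕ-fromℕ< _)) g<i)
  ... | no j≰g  | no g≮i  = contradiction (cut i j (≰⇒> g≮i) (≰⇒> j≰g)) (not-¬ edge)

crossing-edge : ∀ {n c} (G : OGraph n) → ¬ NoEdgeAcross G c →
               ∃₂ λ i j → toℕ i < c × c ≤ toℕ j × Edge G i j
crossing-edge {c = c} G connected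
  with any? (λ i → any? (λ j → (toℕ i <? c) ×-dec (c ≤? toℕ j) ×-dec (adj G i j ≟ᵇ true)))
... | yes (i , j , crossing) = i , j , crossing
... | no  noCrossing = contradiction cut connected
  where
  cut : NoEdgeAcross G c
  cut i j i<c c≤j = ¬-not λ edge → noCrossing (i , j , i<c , c≤j , edge)

module _ {s r N₁ N₂} {f : Fin s → Fin N₁} {g : Fin r → Fin N₂}
         (f-inc : StrictlyIncreasing f) (g-inc : StrictlyIncreasing g) where

  join-map-increasing : ∀ p q → toℕ (join s r p) < toℕ (join s r q) →
    toℕ (join N₁ N₂ (Sum.map f g p)) < toℕ (join N₁ N₂ (Sum.map f g q))
  join-map-increasing (inj₁ u) (inj₁ v) u<v
    rewrite toℕ-↑ˡ u r | toℕ-↑ˡ v r | toℕ-↑ˡ (f u) N₂ | toℕ-↑ˡ (f v) N₂ = f-inc u v u<v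
  join-map-increasing (inj₁ u) (inj₂ v) _
    rewrite toℕ-↑ˡ (f u) N₂ | toℕ-↑ʳ N₁ (g v) = <-≤-trans (toℕ<n (f u)) (m≤m+n N₁ _)
  join-map-increasing (inj₂ u) (inj₁ v) s+u<v
    rewrite toℕ-↑ʳ s u | toℕ-↑ˡ v r = contradiction (<-trans s+u<v (toℕ<n v)) (m+n≮m s _)
  join-map-increasing (inj₂ u) (inj₂ v) s+u<s+v
    rewrite toℕ-↑ʳ s u | toℕ-↑ʳ s v | toℕ-↑ʳ N₁ (g u) | toℕ-↑ʳ N₁ (g v) =
    +-monoʳ-< N₁ (g-inc u v (+-cancelˡ-< s _ _ s+u<s+v))

infixr 5 _⊕ᵉ_

_⊕ᵉ_ : ∀ {s r N₁ N₂} → Emb s N₁ → Emb r N₂ → Emb (s + r) (N₁ + N₂)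
_⊕ᵉ_ {s} {r} {N₁} {N₂} b x = record
  { emb  = join N₁ N₂ ∘ Sum.map (emb b) (emb x) ∘ splitAt s
  ; mono = λ i j i<j → join-map-increasing (mono b) (mono x) (splitAt s i) (splitAt s j)
             (subst₂ _<_ (cong toℕ (sym (join-splitAt s r i))) (cong toℕ (sym (join-splitAt s r j))) i<j)
  }

module _ {s r N₁ N₂} (G₁ : OGraph N₁) (G₂ : OGraph N₂) (b : Emb s N₁) (x : Emb r N₂) where

  combine-map : ∀ p q → combine G₁ G₂ (Sum.map (emb b) (emb x) p) (Sum.map (emb b) (emb x) q)
                      ≡ combine (induced G₁ b) (induced G₂ x) p q
  combine-map (inj₁ _) (inj₁ _) = refl
  combine-map (inj₁ _) (inj₂ _) = refl
  combine-map (inj₂ _) (inj₁ _) = refl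
  combine-map (inj₂ _) (inj₂ _) = refl

  induced-⊕ᵉ : induced (G₁ ⊕ G₂) (b ⊕ᵉ x) ≋ induced G₁ b ⊕ induced G₂ x
  induced-⊕ᵉ = sameAdjacency λ i j →
    trans (cong₂ (combine G₁ G₂) (splitAt-join N₁ N₂ (part i)) (splitAt-join N₁ N₂ (part j)))
          (combine-map (splitAt s i) (splitAt s j))
    where
    part : Fin (s + r) → Fin N₁ ⊎ Fin N₂
    part = Sum.map (emb b) (emb x) ∘ splitAt s

module _ {s r} (G : OGraph s) (H : OGraph r) where

  adj-⊕-↑ˡ : ∀ i j → adj (G ⊕ H) (i ↑ˡ r) (j ↑ˡ r) ≡ adj G i j
  adj-⊕-↑ˡ i j rewrite splitAt-↑ˡ s i r | splitAt-↑ˡ s j r = refl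

  adj-⊕-↑ʳ : ∀ i j → adj (G ⊕ H) (s ↑ʳ i) (s ↑ʳ j) ≡ adj H i j
  adj-⊕-↑ʳ i j rewrite splitAt-↑ʳ s r i | splitAt-↑ʳ s r j = refl

  NoEdgeAcross-⊕ : NoEdgeAcross (G ⊕ H) s
  NoEdgeAcross-⊕ i j i<s s≤j rewrite splitAt-< s i i<s | splitAt-≥ s j s≤j = refl

  NoEdgeAcross-⊕⁻ˡ : ∀ {c} → NoEdgeAcross (G ⊕ H) c → NoEdgeAcross G c
  NoEdgeAcross-⊕⁻ˡ cut i j i<c c≤j = trans (sym (adj-⊕-↑ˡ i j))
    (cut _ _ (subst (_< _) (sym (toℕ-↑ˡ i r)) i<c) (subst (_ ≤_) (sym (toℕ-↑ˡ j r)) c≤j))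

  FirstBlock-⊕ : Connected G → FirstBlock (G ⊕ H) s
  FirstBlock-⊕ connected = NoEdgeAcross-⊕ , λ c 0<c c<s → connected c 0<c c<s ∘ NoEdgeAcross-⊕⁻ˡ

module _ {s r} {G G′ : OGraph s} {H H′ : OGraph r} (eq : G ⊕ H ≋ G′ ⊕ H′) where

  ⊕-cancelˡ : G ≋ G′
  ⊕-cancelˡ = sameAdjacency λ i j →
    trans (sym (adj-⊕-↑ˡ G H i j)) (trans (adj-≡ eq _ _) (adj-⊕-↑ˡ G′ H′ i j))

  ⊕-cancelʳ : H ≋ H′
  ⊕-cancelʳ = sameAdjacency λ i j →
    trans (sym (adj-⊕-↑ʳ G H i j)) (trans (adj-≡ eq _ _) (adj-⊕-↑ʳ G′ H′ i j))

Distinct : ∀ {n N} → OGraph N → Emb n N → Emb n N → Set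
Distinct G e e′ = ¬ induced G e ≋ induced G e′

Distinct-order-positive : ∀ {m N} {G : OGraph N} {e e′ : Emb m N} → Distinct G e e′ → 0 < m
Distinct-order-positive {zero}  e≉e′ = contradiction (sameAdjacency λ ()) e≉e′
Distinct-order-positive {suc _} _    = s≤s z≤n

module _ {s r N₁ N₂ : ℕ} (G₁ : OGraph N₁) (G₂ : OGraph N₂) where

  ⊕ᵉ-distinctˡ : ∀ {b b′ : Emb s N₁} (x x′ : Emb r N₂) →
                 Distinct G₁ b b′ → Distinct (G₁ ⊕ G₂) (b ⊕ᵉ x) (b′ ⊕ᵉ x′)
  ⊕ᵉ-distinctˡ {b} {b′} x x′ b≉b′ eq =
    b≉b′ (⊕-cancelˡ (≋-trans (≋-sym (induced-⊕ᵉ G₁ G₂ b x)) (≋-trans eq (induced-⊕ᵉ G₁ G₂ b′ x′))))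

  ⊕ᵉ-distinctʳ : ∀ (b : Emb s N₁) {x x′ : Emb r N₂} →
                 Distinct G₂ x x′ → Distinct (G₁ ⊕ G₂) (b ⊕ᵉ x) (b ⊕ᵉ x′)
  ⊕ᵉ-distinctʳ b {x} {x′} x≉x′ eq =
    x≉x′ (⊕-cancelʳ (≋-trans (≋-sym (induced-⊕ᵉ G₁ G₂ b x)) (≋-trans eq (induced-⊕ᵉ G₁ G₂ b x′))))

  FirstBlock-⊕ᵉ : ∀ (b : Emb s N₁) (x : Emb r N₂) → Connected (induced G₁ b) →
                  FirstBlock (induced (G₁ ⊕ G₂) (b ⊕ᵉ x)) s
  FirstBlock-⊕ᵉ b x connected =
    FirstBlock-resp-≋ (≋-sym (induced-⊕ᵉ G₁ G₂ b x)) (FirstBlock-⊕ _ _ connected)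

_∘ᵉ_ : ∀ {s m N} → Emb m N → Emb s m → Emb s N
A ∘ᵉ e = record { emb = emb A ∘ emb e ; mono = λ i j i<j → mono A _ _ (mono e i j i<j) }

module _ {m} {c} (j : Fin m) (c≤j : c ≤ toℕ j) where

  prefix▷-vertex : Fin (suc c) → Fin m
  prefix▷-vertex p with toℕ p <? c
  ... | yes p<c = fromℕ< (<-≤-trans p<c (≤-trans c≤j (<⇒≤ (toℕ<n j))))
  ... | no  _   = j

  prefix▷-vertex-< : ∀ p → toℕ p < c → toℕ (prefix▷-vertex p) ≡ toℕ p
  prefix▷-vertex-< p p<c with toℕ p <? c
  ... | yes _   = toℕ-fromℕ< _
  ... | no  p≮c = contradiction p<c p≮c

  prefix▷-vertex-≥ : ∀ p → ¬ toℕ p < c → prefix▷-vertex p ≡ j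
  prefix▷-vertex-≥ p p≮c with toℕ p <? c
  ... | yes p<c = contradiction p<c p≮c
  ... | no  _   = refl

  prefix▷-increasing : StrictlyIncreasing prefix▷-vertex
  prefix▷-increasing p q p<q = by-cases (toℕ q <? c) (toℕ p <? c)
    where
    by-cases : Dec (toℕ q < c) → Dec (toℕ p < c) → prefix▷-vertex p Fin.< prefix▷-vertex q
    by-cases (yes q<c) _         = subst₂ _<_ (sym (prefix▷-vertex-< p (<-trans p<q q<c)))
                                              (sym (prefix▷-vertex-< q q<c)) p<q
    by-cases (no  q≮c) (yes p<c) = subst₂ _<_ (sym (prefix▷-vertex-< p p<c))
                                              (cong toℕ (sym (prefix▷-vertex-≥ q q≮c))) (<-≤-trans p<c c≤j)
    by-cases (no  _)   (no  p≮c) = contradiction (<-≤-trans p<q (s≤s⁻¹ (toℕ<n q))) p≮c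

  prefix▷ : Emb (suc c) m
  prefix▷ = record { emb = prefix▷-vertex ; mono = prefix▷-increasing }

module _ {m} (H : OGraph m) where

  Member : ℕ → Fin m → Fin m → Set
  Member c j y = toℕ y < c ⊎ y ≡ j

  CrossedWithin : ℕ → Fin m → ℕ → Set
  CrossedWithin c j d = ∃₂ λ x y → toℕ x < d × d ≤ toℕ y × Member c j y × Edge H x y

  -- H is connected on {0, …, c − 1} ∪ {j}; attached lets j survive when the prefix grows.
  record Extension (c : ℕ) (j : Fin m) : Set where
    field
      c≤j      : c ≤ toℕ j
      crossed  : ∀ d → 0 < d → d ≤ c → CrossedWithin c j d
      attached : c < toℕ j → ∃ λ x → toℕ x < c × Edge H x j
  open Extension

  module _ {c} {j : Fin m} (c≤j : c ≤ toℕ j) where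

    prefix-position : ∀ y → toℕ y < c → ∃ λ p → toℕ p ≡ toℕ y × prefix▷-vertex j c≤j p ≡ y
    prefix-position y y<c = p , toℕ-fromℕ< _ , toℕ-injective (trans
      (prefix▷-vertex-< j c≤j p (subst (_< c) (sym (toℕ-fromℕ< _)) y<c)) (toℕ-fromℕ< _))
      where p = fromℕ< (m<n⇒m<1+n y<c)

    member-position : ∀ {d y} → Member c j y → d ≤ c → d ≤ toℕ y →
                      ∃ λ p → d ≤ toℕ p × prefix▷-vertex j c≤j p ≡ y
    member-position (inj₁ y<c) _ d≤y with prefix-position _ y<c
    ... | p , p≡y , vertex≡y = p , subst (_ ≤_) (sym p≡y) d≤y , vertex≡y
    member-position (inj₂ refl) d≤c _ =
      fromℕ c , subst (_ ≤_) (sym (toℕ-fromℕ c)) d≤c ,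
      prefix▷-vertex-≥ j c≤j (fromℕ c) (<-irrefl (toℕ-fromℕ c))

  Extension⇒Connected : ∀ {c j} (ext : Extension c j) → Connected (induced H (prefix▷ j (c≤j ext)))
  Extension⇒Connected {c} ext d 0<d d<c+1 cut
    with crossed ext d 0<d (s≤s⁻¹ d<c+1)
  ... | x , y , x<d , d≤y , y∈ , edge
    with prefix-position (c≤j ext) x (<-≤-trans x<d (s≤s⁻¹ d<c+1))
       | member-position (c≤j ext) y∈ (s≤s⁻¹ d<c+1) d≤y
  ... | px , px≡x , vertex≡x | py , d≤py , vertex≡y =
    contradiction (cut px py (subst (_< d) (sym px≡x) x<d) d≤py)
                  (not-¬ (subst₂ (Edge H) (sym vertex≡x) (sym vertex≡y) edge))

  crossed-suc : ∀ {c j j′} → (∀ {y} → Member c j y → Member (suc c) j′ y) →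
                (∀ d → 0 < d → d ≤ c → CrossedWithin c j d) → CrossedWithin (suc c) j′ (suc c) →
                ∀ d → 0 < d → d ≤ suc c → CrossedWithin (suc c) j′ d
  crossed-suc widen crossed top d 0<d d≤c+1 with m≤n⇒m<n∨m≡n d≤c+1
  ... | inj₂ refl = top
  ... | inj₁ d<c+1 with crossed d 0<d (s≤s⁻¹ d<c+1)
  ...   | x , y , x<d , d≤y , y∈ , edge = x , y , x<d , d≤y , widen y∈ , edge

  extension-keep : ∀ {c j} → Extension c j → c < toℕ j → Extension (suc c) j
  extension-keep ext c<j with attached ext c<j
  ... | x , x<c , edge = record
    { c≤j      = c<j
    ; crossed  = crossed-suc (Sum.map₁ m<n⇒m<1+n) (crossed ext) (x , _ , m<n⇒m<1+n x<c , c<j , inj₂ refl , edge)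
    ; attached = λ _ → x , m<n⇒m<1+n x<c , edge
    }

  extension-move : ∀ {c j} → Extension c j → toℕ j ≡ c →
                   ∀ x y → toℕ x < suc c → suc c ≤ toℕ y → Edge H x y → Extension (suc c) y
  extension-move {c} ext j≡c x y x<c+1 c<y edge = record
    { c≤j      = c<y
    ; crossed  = crossed-suc (inj₁ ∘ into-prefix) (crossed ext) (x , y , x<c+1 , c<y , inj₂ refl , edge)
    ; attached = λ _ → x , x<c+1 , edge
    }
    where
    into-prefix : ∀ {z} → Member c _ z → toℕ z < suc c
    into-prefix (inj₁ z<c)  = m<n⇒m<1+n z<c
    into-prefix (inj₂ refl) = s≤s (≤-reflexive j≡c)

  extension : Connected H → ∀ c → c < m → ∃ (Extension c)
  extension _ zero 0<m = fromℕ< 0<m , record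
    { c≤j      = z≤n
    ; crossed  = λ d 0<d d≤0 → contradiction (<-≤-trans 0<d d≤0) (<-irrefl refl)
    ; attached = λ 0<j → contradiction (subst (0 <_) (toℕ-fromℕ< 0<m) 0<j) (<-irrefl refl)
    }
  extension connected (suc c) c+1<m with extension connected c (<-trans (n<1+n c) c+1<m)
  ... | j , ext with m≤n⇒m<n∨m≡n (c≤j ext)
  ...   | inj₁ c<j = j , extension-keep ext c<j
  ...   | inj₂ c≡j with crossing-edge H (connected (suc c) (s≤s z≤n) c+1<m)
  ...     | x , y , x<c+1 , c<y , edge = y , extension-move ext (sym c≡j) x y x<c+1 c<y edge

connected-subgraph : ∀ {m} (H : OGraph m) → Connected H → ∀ c → c < m →
                     Σ (Emb (suc c) m) (Connected ∘ induced H)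
connected-subgraph H connected c c<m with extension H connected c c<m
... | j , ext = prefix▷ j (Extension.c≤j ext) , Extension⇒Connected H ext

record Family {N} (G : OGraph N) (n size : ℕ) : Set where
  field
    members  : List (Emb n N)
    large    : size ≤ length members
    distinct : AllPairs (Distinct G) members
open Family

module _ {n N : ℕ} {G : OGraph N} where

  Family⇒SAtLeast : ∀ {size} → Family G n size → SAtLeast G n size
  Family⇒SAtLeast F = pick , λ a b a≢b iso →
    AllPairs-lookup (λ d → d ∘ ≋-sym) (distinct F) (a≢b ∘ inject≤-injective _ _ a b) (Iso⇒≋ iso)
    where
    pick : Fin _ → Emb n N
    pick a = lookup (members F) (Fin.inject≤ a (large F))

  shrink : ∀ {a b} → a ≤ b → Family G n b → Family G n a
  shrink a≤b F = record { members = members F ; large = ≤-trans a≤b (large F) ; distinct = distinct F }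

  union : ∀ {a b} (F : Family G n a) (F′ : Family G n b) →
          All (λ e → All (Distinct G e) (members F′)) (members F) → Family G n (a + b)
  union F F′ across = record
    { members  = members F ++ members F′
    ; large    = subst (_ ≤_) (sym (length-++ (members F))) (+-mono-≤ (large F) (large F′))
    ; distinct = AllPairs.++⁺ (distinct F) (distinct F′) across
    }

module ⊕-Families {N₁ N₂} (G₁ : OGraph N₁) (G₂ : OGraph N₂) where

  _⊕ᶠ_ : ∀ {s r size} (b : Emb s N₁) → Family G₂ r size → Family (G₁ ⊕ G₂) (s + r) size
  b ⊕ᶠ F = record
    { members  = map (b ⊕ᵉ_) (members F)
    ; large    = subst (_ ≤_) (sym (length-map _ (members F))) (large F)
    ; distinct = AllPairs.map⁺ (AllPairs.map (λ {x} {x′} → ⊕ᵉ-distinctʳ G₁ G₂ b {x} {x′}) (distinct F))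
    }

  ⊕ᶠ-FirstBlock : ∀ {s r size} (b : Emb s N₁) (F : Family G₂ r size) → Connected (induced G₁ b) →
                  All (λ e → FirstBlock (induced (G₁ ⊕ G₂) e) s) (members (b ⊕ᶠ F))
  ⊕ᶠ-FirstBlock b F connected = All-map-universal (λ x → FirstBlock-⊕ᵉ G₁ G₂ b x connected) (members F)

  ⊕ᶠ-distinct : ∀ {s r a b} {B B′ : Emb s N₁} (F : Family G₂ r a) (F′ : Family G₂ r b) → Distinct G₁ B B′ →
                All (λ e → All (Distinct (G₁ ⊕ G₂) e) (members (B′ ⊕ᶠ F′))) (members (B ⊕ᶠ F))
  ⊕ᶠ-distinct {B = B} {B′} F F′ B≉B′ = All-map-universal (λ x →
    All-map-universal (λ x′ → ⊕ᵉ-distinctˡ G₁ G₂ {B} {B′} x x′ B≉B′) (members F′)) (members F)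

BlockAtLeast : ∀ {n N} → OGraph N → ℕ → Emb n N → Set
BlockAtLeast G s e = ∃ λ t → s ≤ t × FirstBlock (induced G e) t

module _ {n N : ℕ} (G : OGraph N) where

  FirstBlock⇒BlockAtLeast : ∀ {s} {L : List (Emb n N)} →
    All (λ e → FirstBlock (induced G e) s) L → All (BlockAtLeast G s) L
  FirstBlock⇒BlockAtLeast = All.map λ first → _ , ≤-refl , first

  BlockAtLeast-suc : ∀ {s} {L : List (Emb n N)} → All (BlockAtLeast G (suc s)) L → All (BlockAtLeast G s) L
  BlockAtLeast-suc = All.map λ (t , s<t , first) → t , <⇒≤ s<t , first

  FirstBlock-separates : ∀ {s} {L L′ : List (Emb n N)} → 0 < s →
    All (λ e → FirstBlock (induced G e) s) L → All (BlockAtLeast G (suc s)) L′ →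
    All (λ e → All (Distinct G e) L′) L
  FirstBlock-separates 0<s firsts laters =
    All.map (λ first → All.map (λ (_ , s<t , later) → FirstBlock-distinct first later 0<s s<t) laters) firsts

2^n≤2^pred[n]+2^pred[n] : ∀ n → 2 ^ n ≤ 2 ^ (n ∸ 1) + 2 ^ (n ∸ 1)
2^n≤2^pred[n]+2^pred[n] zero    = s≤s z≤n
2^n≤2^pred[n]+2^pred[n] (suc n) = ≤-reflexive (cong (2 ^ n +_) (+-identityʳ (2 ^ n)))

module _ {N₁ N₂} (G₁ : OGraph N₁) (G₂ : OGraph N₂) {m} (A B : Emb m N₁)
         (A-connected : Connected (induced G₁ A)) (B-connected : Connected (induced G₁ B))
         (A≉B : Distinct G₁ A B) where

  open ⊕-Families G₁ G₂

  G = G₁ ⊕ G₂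

  FamiliesUpTo : ℕ → Set
  FamiliesUpTo r = ∀ r′ → r′ ≤ r → Family G₂ r′ (2 ^ (r′ ∸ 1))

  BlockFamily : ℕ → ℕ → ℕ → Set
  BlockFamily n size s = Σ (Family G n size) (All (BlockAtLeast G s) ∘ members)

  connected-in-A : ∀ c → c < m → Σ (Emb (suc c) N₁) (Connected ∘ induced G₁)
  connected-in-A c c<m with connected-subgraph (induced G₁ A) A-connected c c<m
  ... | e , connected = A ∘ᵉ e , connected

  build : ∀ s r → 0 < s → s ≤ m → FamiliesUpTo r → BlockFamily (s + r) (2 ^ r) s
  build s r 0<s s≤m families with m≤n⇒m<n∨m≡n s≤m
  ... | inj₂ refl =
    shrink (2^n≤2^pred[n]+2^pred[n] r) (union (A ⊕ᶠ F) (B ⊕ᶠ F) (⊕ᶠ-distinct F F A≉B)) ,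
    All.++⁺ (FirstBlock⇒BlockAtLeast G (⊕ᶠ-FirstBlock A F A-connected))
            (FirstBlock⇒BlockAtLeast G (⊕ᶠ-FirstBlock B F B-connected))
    where F = families r ≤-refl
  build (suc c) zero 0<s s≤m families | inj₁ s<m with connected-in-A c (<-trans (n<1+n c) s<m)
  ... | b , connected = b ⊕ᶠ F , FirstBlock⇒BlockAtLeast G (⊕ᶠ-FirstBlock b F connected)
    where F = families 0 z≤n
  build (suc c) (suc r) 0<s s≤m families | inj₁ s<m with connected-in-A c (<-trans (n<1+n c) s<m)
  ... | b , connected =
    shrink (2^n≤2^pred[n]+2^pred[n] (suc r)) (union (b ⊕ᶠ F) (proj₁ later) separated) ,
    All.++⁺ (FirstBlock⇒BlockAtLeast G firsts) (BlockAtLeast-suc G (proj₂ later))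
    where
    F = families (suc r) ≤-refl
    firsts = ⊕ᶠ-FirstBlock b F connected
    later : BlockFamily (suc c + suc r) (2 ^ r) (suc (suc c))
    later = subst (λ n → BlockFamily n (2 ^ r) (suc (suc c))) (sym (+-suc (suc c) r))
                  (build (suc (suc c)) r (s≤s z≤n) s<m λ r′ r′≤r → families r′ (m≤n⇒m≤1+n r′≤r))
    separated = FirstBlock-separates G 0<s firsts (proj₂ later)

sumGraphs-family : ∀ k ns (Gs : (i : Fin k) → OGraph (ns i)) →
                   ((i : Fin k) → Σ ℕ (TwoDistinctIrreducible (Gs i))) →
                   ∀ n → n ≤ k → Family (sumGraphs k ns Gs) n (2 ^ (n ∸ 1))
sumGraphs-family k ns Gs pairs zero _ = record
  { members = record { emb = λ () ; mono = λ () } ∷ [] ; large = ≤-refl ; distinct = [] ∷ [] }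
sumGraphs-family (suc k) ns Gs pairs (suc n) (s≤s n≤k) with pairs zero
... | m , A , B , A-irreducible , B-irreducible , A≄B =
  proj₁ (build G₁ G₂ A B (Irreducible⇒Connected (induced G₁ A) A-irreducible)
                         (Irreducible⇒Connected (induced G₁ B) B-irreducible)
                         A≉B 1 n (s≤s z≤n) (Distinct-order-positive {G = G₁} {A} {B} A≉B) families)
  where
  G₁ = Gs zero
  G₂ = sumGraphs k (ns ∘ suc) (Gs ∘ suc)
  A≉B : Distinct G₁ A B
  A≉B = A≄B ∘ ≋⇒Iso
  families : ∀ r → r ≤ n → Family G₂ r (2 ^ (r ∸ 1))
  families r r≤n = sumGraphs-family k (ns ∘ suc) (Gs ∘ suc) (pairs ∘ suc) r (≤-trans r≤n n≤k)

lemma5p4 : (k : ℕ) (ns : Fin k → ℕ) (Gs : (i : Fin k) → OGraph (ns i)) →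
    ((i : Fin k) → Σ ℕ (λ m → TwoDistinctIrreducible (Gs i) m)) →
    (n : ℕ) → n ≤ k → SAtLeast (sumGraphs k ns Gs) n (2 ^ (n ∸ 1))
lemma5p4 k ns Gs pairs n n≤k = Family⇒SAtLeast (sumGraphs-family k ns Gs pairs n n≤k)
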